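{- Let $G$ be a circular-arc graph of diameter $2$ that has a disconnected cut. Then $G$ has a disconnected partition $V_1,V_2,V_3,V_4$ such that each $G[V_i]$ is connected.
   Context: Graphs are finite, simple, undirected. A circular-arc graph has a representation assigning to each vertex an arc of a circle such that two vertices are adjacent iff their arcs intersect. For a connected graph $G=(V,E)$, a set $U\subseteq V$ is a disconnected cut if both $G-U$ and $G[U]$ are disconnected. A disconnected partition of $G$ is a partition of $V(G)$ into four non-empty sets $V_1,V_2,V_3,V_4$ such that no vertex of $V_1$ is adjacent to a vertex of $V_3$ and no vertex of $V_2$ is adjacent to a vertex of $V_4$. -}

module Defs where

open import Level using (0ℓ)
open import Data.Nat using (ℕ; suc; _+_; _∸_; _≤_; _<_; _%_)
open import Data.Fin using (Fin; toℕ)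
open import Data.Product using (Σ; ∃; ∃-syntax; _×_; _,_)
open import Data.Sum using (_⊎_)
open import Relation.Nullary using (¬_)
open import Relation.Unary using (Pred; ∁)
open import Relation.Binary.PropositionalEquality using (_≡_; _≢_)
open import Function.Bundles using (_⇔_)

record Graph (n : ℕ) : Set₁ where
  field
    Adj    : Fin n → Fin n → Set
    sym    : ∀ {u v} → Adj u v → Adj v u
    irrefl : ∀ {u} → ¬ Adj u u
open Graph public

-- The circle is discretised into m points 0,…,m-1 in cyclic order
-- (every finite circular-arc graph has a representation whose arc
-- endpoints are finitely many points on the circle).  An arc is given
-- by a start point s and a length l < m and consists of the points
-- s, s+1, …, s+l (mod m); l = m-1 gives the whole circle.

record Arc (m : ℕ) : Set where
  constructor arc
  field
    start  : Fin m
    len    : ℕ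
    len<m  : len < m

_∈Arc_ : ∀ {m} → Fin m → Arc m → Set
_∈Arc_ {m} p (arc s l _) = ((toℕ p + m) ∸ toℕ s) % suc (m ∸ 1) ≤ l

ArcsIntersect : ∀ {m} → Arc m → Arc m → Set
ArcsIntersect {m} a b = ∃[ p ] (p ∈Arc a × p ∈Arc b)

IsCircularArcGraph : ∀ {n} → Graph n → Set
IsCircularArcGraph {n} G =
  ∃[ m ] Σ (Fin n → Arc m) λ arcs →
    ∀ u v → u ≢ v → (Adj G u v ⇔ ArcsIntersect (arcs u) (arcs v))

data Reach {n} (G : Graph n) (U : Pred (Fin n) 0ℓ) : Fin n → Fin n → Set where
  here : ∀ {u} → U u → Reach G U u u
  step : ∀ {u w v} → U u → Adj G u w → Reach G U w v → Reach G U u v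

InducedConnected : ∀ {n} → Graph n → Pred (Fin n) 0ℓ → Set
InducedConnected G U =
  (∃[ u ] U u) × (∀ u v → U u → U v → Reach G U u v)

InducedDisconnected : ∀ {n} → Graph n → Pred (Fin n) 0ℓ → Set
InducedDisconnected G U =
  ∃[ u ] ∃[ v ] (U u × U v × ¬ Reach G U u v)

All : ∀ {n} → Pred (Fin n) 0ℓ
All _ = Data.Unit.⊤
  where import Data.Unit

Connected : ∀ {n} → Graph n → Set
Connected G = InducedConnected G All

DisconnectedCut : ∀ {n} → Graph n → Pred (Fin n) 0ℓ → Set
DisconnectedCut G U = InducedDisconnected G (∁ U) × InducedDisconnected G U

Diameter2 : ∀ {n} → Graph n → Set
Diameter2 {n} G =
  Connected G ×
  (∀ u v → u ≡ v ⊎ Adj G u v ⊎ ∃[ w ] (Adj G u w × Adj G w v)) ×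
  (∃[ u ] ∃[ v ] (u ≢ v × ¬ Adj G u v))

-- Disconnected partitions, given as a labelling  part : Fin n → Fin 4
-- with V_i = { v | part v ≡ i }  (i = 0,1,2,3 for V_1,…,V_4).

Part : ∀ {n} → (Fin n → Fin 4) → Fin 4 → Pred (Fin n) 0ℓ
Part part i v = part v ≡ i

IsDisconnectedPartition : ∀ {n} → Graph n → (Fin n → Fin 4) → Set
IsDisconnectedPartition G part =
  (∀ i → ∃[ v ] Part part i v) ×
  (∀ u v → Part part Fin.zero u → Part part (Fin.suc (Fin.suc Fin.zero)) v → ¬ Adj G u v) ×
  (∀ u v → Part part (Fin.suc Fin.zero) u → Part part (Fin.suc (Fin.suc (Fin.suc Fin.zero))) v → ¬ Adj G u v)
  where import Data.Fin as Fin

{-# OPTIONS --safe #-}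
module Submission where

-- Take a disconnected cut U, vertices a₁, a₂ in different components of G[U] and b₁, b₂ in
-- different components of G − U. Let V₁ be the component of a₁ in G[U], V₃ = U ∖ V₁, and V₂, V₄
-- the same for b₁ in G − U. Everything is immediate except that V₃ and V₄ are connected, i.e.
-- that neither side of the cut has three components. By diameter 2, every component of one side
-- is joined by an edge to every component of the other. In a circular-arc model the arcs of a
-- connected vertex set cover an arc of the circle, and different components of one side cover
-- disjoint arcs. But two disjoint arcs cannot both meet three pairwise disjoint arcs: each of the
-- three contains an end of one of the two. Constructively U need not be decidable; since being a
-- disconnected cut is a decidable property of subsets of Fin n, a decidable cut is found instead.

open import Defs
open import Data.Nat using (ℕ)
open import Data.Fin using (Fin)
open import Data.Product using (∃; ∃-syntax; _×_; _,_)
open import Relation.Unary using (Pred)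

open import Level using (0ℓ)
open import Function using (_∘_)
open import Function.Bundles using (_⇔_; Equivalence)
open import Data.Empty using (⊥; ⊥-elim)
open import Data.Product using (proj₁; proj₂)
open import Data.Sum using (_⊎_; inj₁; inj₂; [_,_]′; swap)
open import Data.Nat using (NonZero; zero; suc; _+_; _∸_; _≤_; _<_; _⊔_; _%_; z≤n; s≤s; _≤?_; _<?_)
open import Data.Nat.Properties
  using (≤-trans; ≤-reflexive; <⇒≤; ≤-<-trans; <-trans; ≰⇒>; ≮⇒≥; <⇒≱; ≤-total; <⇒≤pred; n<1+n;
         +-comm; +-assoc; +-identityʳ; +-mono-<; +-monoʳ-≤; +-monoˡ-≤; +-cancelˡ-≤; +-cancelˡ-<;
         m≤n+m; m≤m+n; m+n≮n; m+[n∸m]≡n; m∸n+n≡m; +-∸-assoc; m<n+o⇒m∸n<o;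
         m≤n⊔m; m≤n⇒m≤n⊔o; m≤n⇒m⊔n≡n; m≥n⇒m⊔n≡m; ⊔-pres-<m; module ≤-Reasoning)
open import Data.Nat.DivMod using (m%n<n; m<n⇒m%n≡m; [m+n]%n≡m%n; m%n%n≡m%n; %-distribˡ-+)
open import Data.Fin using (zero; suc; toℕ; fromℕ<; _≟_)
open import Data.Fin.Properties using (toℕ<n; toℕ-fromℕ<; any?)
open import Data.Fin.Subset using (Subset) renaming (_∈_ to _∈ₛ_)
open import Data.Fin.Subset.Properties using (_∈?_; anySubset?)
open import Data.List using (List; []; _∷_; allFin)
open import Data.List.Relation.Unary.Any as Any using ()
open import Data.List.Relation.Unary.All as List using ([]; _∷_)
open import Data.List.Membership.Propositional using (_∈_)
open import Data.List.Membership.Propositional.Properties using (∈-allFin; ∉[])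
open import Data.Vec using (tabulate)
open import Data.Vec.Properties using (lookup∘tabulate; lookup⇒[]=; []=⇒lookup)
open import Relation.Nullary using (¬_; Dec; yes; no; contradiction)
open import Relation.Nullary.Decidable
  using (_×-dec_; _⊎-dec_; map′; ¬?; does; dec-true; toSum; decidable-stable; ¬¬-excluded-middle)
open import Relation.Unary using (Decidable; _⊆_; _⊆′_; _≐_; _∪_; ∁)
open import Relation.Unary.Properties using (∁?; ≐-sym)
open import Relation.Binary.PropositionalEquality as ≡ using (_≡_; _≢_; refl)

-- Reachability in induced subgraphs

module _ {n} (G : Graph n) where

  reach-start : ∀ {S u v} → Reach G S u v → S u
  reach-start (here u∈S)     = u∈S
  reach-start (step u∈S _ _) = u∈S

  reach-end : ∀ {S u v} → Reach G S u v → S v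
  reach-end (here v∈S)     = v∈S
  reach-end (step _ _ w⇝v) = reach-end w⇝v

  reach-trans : ∀ {S u v w} → Reach G S u v → Reach G S v w → Reach G S u w
  reach-trans (here _)         v⇝w = v⇝w
  reach-trans (step u∈S e x⇝v) v⇝w = step u∈S e (reach-trans x⇝v v⇝w)

  reach-snoc : ∀ {S u v w} → Reach G S u v → Adj G v w → S w → Reach G S u w
  reach-snoc u⇝v e w∈S = reach-trans u⇝v (step (reach-end u⇝v) e (here w∈S))

  reach-sym : ∀ {S u v} → Reach G S u v → Reach G S v u
  reach-sym (here u∈S)       = here u∈S
  reach-sym (step u∈S e w⇝v) = reach-snoc (reach-sym w⇝v) (sym G e) u∈S

  reach-mono : ∀ {S T u v} → S ⊆ T → Reach G S u v → Reach G T u v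
  reach-mono S⊆T (here u∈S)       = here (S⊆T u∈S)
  reach-mono S⊆T (step u∈S e w⇝v) = step (S⊆T u∈S) e (reach-mono S⊆T w⇝v)

  reach-restrict : ∀ {S T u v} → Reach G S u v → (∀ {t} → Reach G S u t → T t) → Reach G T u v
  reach-restrict (here u∈S)       inT = here (inT (here u∈S))
  reach-restrict (step u∈S e w⇝v) inT = step (inT (here u∈S)) e (reach-restrict w⇝v (inT ∘ step u∈S e))

module Reachability {n} (G : Graph n) (adj? : ∀ u v → Dec (Adj G u v))
                    {S : Pred (Fin n) 0ℓ} (S? : Decidable S) where

  Within : List (Fin n) → Pred (Fin n) 0ℓ
  Within L w = S w × w ∈ L

  -- Paths in S ∩ (x ∷ L) through x, cut at their first and last visit to x.
  Enters : List (Fin n) → Fin n → Fin n → Set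
  Enters L x u = u ≡ x ⊎ ∃[ y ] (Reach G (Within L) u y × Adj G y x)

  Leaves : List (Fin n) → Fin n → Fin n → Set
  Leaves L x v = x ≡ v ⊎ ∃[ y ] (Adj G x y × Reach G (Within L) y v)

  widen : ∀ {x L} → Within L ⊆ Within (x ∷ L)
  widen (w∈S , w∈L) = w∈S , Any.there w∈L

  reach-through : ∀ {x L u v} → S x → Enters L x u → Leaves L x v → Reach G (Within (x ∷ L)) u v
  reach-through {x} {L} {u} {v} x∈S into out = reach-trans G (enter into) (leave out)
    where
      x∈ : Within (x ∷ L) x
      x∈ = x∈S , Any.here refl
      enter : Enters L x u → Reach G (Within (x ∷ L)) u x
      enter (inj₁ refl)            = here x∈
      enter (inj₂ (y , u⇝y , y~x)) = reach-snoc G (reach-mono G widen u⇝y) y~x x∈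
      leave : Leaves L x v → Reach G (Within (x ∷ L)) x v
      leave (inj₁ refl)            = here x∈
      leave (inj₂ (y , x~y , y⇝v)) = step x∈ x~y (reach-mono G widen y⇝v)

  reach-split : ∀ {x L u v} → Reach G (Within (x ∷ L)) u v →
                Reach G (Within L) u v ⊎ (S x × Enters L x u × Leaves L x v)
  reach-split (here (u∈S , Any.here refl)) = inj₂ (u∈S , inj₁ refl , inj₁ refl)
  reach-split (here (u∈S , Any.there u∈L)) = inj₁ (here (u∈S , u∈L))
  reach-split (step {w = w} (u∈S , u∈xL) u~w w⇝v) with reach-split w⇝v | u∈xL
  ... | inj₁ w⇝v′ | Any.here refl = inj₂ (u∈S , inj₁ refl , inj₂ (w , u~w , w⇝v′))
  ... | inj₁ w⇝v′ | Any.there u∈L = inj₁ (step (u∈S , u∈L) u~w w⇝v′)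
  ... | inj₂ (x∈S , _ , out) | Any.here refl = inj₂ (x∈S , inj₁ refl , out)
  ... | inj₂ (x∈S , inj₁ refl , out) | Any.there u∈L =
    inj₂ (x∈S , inj₂ (_ , here (u∈S , u∈L) , u~w) , out)
  ... | inj₂ (x∈S , inj₂ (y , w⇝y , y~x) , out) | Any.there u∈L =
    inj₂ (x∈S , inj₂ (y , step (u∈S , u∈L) u~w w⇝y , y~x) , out)

  reach-within? : ∀ L u v → Dec (Reach G (Within L) u v)
  reach-within? []      u v = no (∉[] ∘ proj₂ ∘ reach-start G)
  reach-within? (x ∷ L) u v =
    map′ [ reach-mono G widen , (λ (x∈S , into , out) → reach-through x∈S into out) ]′ reach-split
      (reach-within? L u v ⊎-dec (S? x ×-dec (enters? ×-dec leaves?)))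
    where
      enters? : Dec (Enters L x u)
      enters? = (u ≟ x) ⊎-dec any? (λ y → reach-within? L u y ×-dec adj? y x)
      leaves? : Dec (Leaves L x v)
      leaves? = (x ≟ v) ⊎-dec any? (λ y → adj? x y ×-dec reach-within? L y v)

  reach? : ∀ u v → Dec (Reach G S u v)
  reach? u v = map′ (reach-mono G proj₁) (reach-mono G (λ {w} w∈S → w∈S , ∈-allFin w))
                    (reach-within? (allFin n) u v)

-- Splitting a cut whose sides have at most two components

WithinDistanceTwo : ∀ {n} → Graph n → Set
WithinDistanceTwo G = ∀ u v → u ≡ v ⊎ Adj G u v ⊎ ∃[ w ] (Adj G u w × Adj G w v)

record Joined {n} (G : Graph n) (S S′ : Pred (Fin n) 0ℓ) (r s : Fin n) : Set where
  constructor joined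
  field
    {near far} : Fin n
    reach-near : Reach G S r near
    reach-far  : Reach G S′ s far
    edge       : Adj G near far

AtMostTwoComponents : ∀ {n} → Graph n → Pred (Fin n) 0ℓ → Set
AtMostTwoComponents G S = ∀ {r₁ r₂ r₃} → S r₁ → S r₂ → S r₃ →
  ¬ Reach G S r₁ r₂ → ¬ Reach G S r₁ r₃ → ¬ Reach G S r₂ r₃ → ⊥

module _ {n} {G : Graph n} where

  joined-at-distance-two : WithinDistanceTwo G → ∀ {S S′} → (∀ w → S w ⊎ S′ w) → (∀ {w} → S w → ¬ S′ w) →
                           ∀ {r s} → S r → S′ s → Joined G S S′ r s
  joined-at-distance-two dist cover disjoint {r} {s} r∈S s∈S′ with dist r s
  ... | inj₁ refl                  = ⊥-elim (disjoint r∈S s∈S′)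
  ... | inj₂ (inj₁ r~s)            = joined (here r∈S) (here s∈S′) r~s
  ... | inj₂ (inj₂ (w , r~w , w~s)) with cover w
  ...   | inj₁ w∈S  = joined (step r∈S r~w (here w∈S)) (here s∈S′) w~s
  ...   | inj₂ w∈S′ = joined (here r∈S) (step s∈S′ (sym G w~s) (here w∈S′)) r~w

module Side {n} (G : Graph n) {S : Pred (Fin n) 0ℓ} (reach? : ∀ u v → Dec (Reach G S u v))
            (two : AtMostTwoComponents G S) {a} (a∈S : S a) where

  Rest : Pred (Fin n) 0ℓ
  Rest v = S v × ¬ Reach G S a v

  component-connected : InducedConnected G (Reach G S a)
  component-connected = (a , here a∈S) , λ u v a⇝u a⇝v →
    reach-restrict G (reach-trans G (reach-sym G a⇝u) a⇝v) (reach-trans G a⇝u)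

  rest-connected : ∀ {a′} → Rest a′ → InducedConnected G Rest
  rest-connected a′∈Rest = (_ , a′∈Rest) , connect
    where
      connect : ∀ u v → Rest u → Rest v → Reach G Rest u v
      connect u v (u∈S , a↛u) (v∈S , a↛v) with reach? u v
      ... | yes u⇝v = reach-restrict G u⇝v λ u⇝t →
                        reach-end G u⇝t , λ a⇝t → a↛u (reach-trans G a⇝t (reach-sym G u⇝t))
      ... | no u↛v  = ⊥-elim (two a∈S u∈S v∈S a↛u a↛v u↛v)

  component-rest-apart : ∀ {u v} → Reach G S a u → Rest v → ¬ Adj G u v
  component-rest-apart a⇝u (v∈S , a↛v) u~v = a↛v (reach-snoc G a⇝u u~v v∈S)

module _ {n} {G : Graph n} {P Q : Pred (Fin n) 0ℓ} where

  induced-connected-resp : P ≐ Q → InducedConnected G P → InducedConnected G Q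
  induced-connected-resp (P⊆Q , Q⊆P) ((u , u∈P) , connect) =
    (u , P⊆Q u∈P) , λ u v u∈Q v∈Q → reach-mono G P⊆Q (connect u v (Q⊆P u∈Q) (Q⊆P v∈Q))

  induced-disconnected-resp : P ≐ Q → InducedDisconnected G P → InducedDisconnected G Q
  induced-disconnected-resp (P⊆Q , Q⊆P) (u , v , u∈P , v∈P , u↛v) =
    u , v , P⊆Q u∈P , P⊆Q v∈P , u↛v ∘ reach-mono G Q⊆P

∁-resp-≐ : ∀ {n} {P Q : Pred (Fin n) 0ℓ} → P ≐ Q → ∁ P ≐ ∁ Q
∁-resp-≐ (P⊆Q , Q⊆P) = (λ ∉P → ∉P ∘ Q⊆P) , (λ ∉Q → ∉Q ∘ P⊆Q)

disconnected-cut-resp : ∀ {n} {G : Graph n} {P Q} → P ≐ Q → DisconnectedCut G P → DisconnectedCut G Q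
disconnected-cut-resp P≐Q (outside , inside) =
  induced-disconnected-resp (∁-resp-≐ P≐Q) outside , induced-disconnected-resp P≐Q inside

ConnectedDisconnectedPartition : ∀ {n} → Graph n → (Fin n → Fin 4) → Set
ConnectedDisconnectedPartition G part =
  IsDisconnectedPartition G part × (∀ i → InducedConnected G (Part part i))

module Labelling {n} (G : Graph n) (V : Fin 4 → Pred (Fin n) 0ℓ)
                 (classify : ∀ v → ∃[ i ] V i v) (unique : ∀ {i j v} → V i v → V j v → i ≡ j) where

  label : Fin n → Fin 4
  label = proj₁ ∘ classify

  Part-label : ∀ i → Part label i ≐ V i
  Part-label i = (λ {v} label≡i → ≡.subst (λ j → V j v) label≡i (proj₂ (classify v)))
               , (λ {v} → unique (proj₂ (classify v)))

  label-partition : (∀ i → InducedConnected G (V i)) →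
                    (∀ {u v} → V zero u → V (suc (suc zero)) v → ¬ Adj G u v) →
                    (∀ {u v} → V (suc zero) u → V (suc (suc (suc zero))) v → ¬ Adj G u v) →
                    ConnectedDisconnectedPartition G label
  label-partition connected apart₁₃ apart₂₄ =
    (nonempty , (λ u v u∈ v∈ → apart₁₃ (into u∈) (into v∈)) , (λ u v u∈ v∈ → apart₂₄ (into u∈) (into v∈))) ,
    (λ i → induced-connected-resp (≐-sym (Part-label i)) (connected i))
    where
      into : ∀ {i} → Part label i ⊆ V i
      into {i} = proj₁ (Part-label i)
      nonempty : ∀ i → ∃[ v ] Part label i v
      nonempty i = let v , v∈V = proj₁ (connected i) in v , proj₂ (Part-label i) v∈V

partition-of-cut : ∀ {n} (G : Graph n) → (∀ u v → Dec (Adj G u v)) → ∀ {U} → Decidable U →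
                   AtMostTwoComponents G U → AtMostTwoComponents G (∁ U) →
                   DisconnectedCut G U → ∃ (ConnectedDisconnectedPartition G)
partition-of-cut {n} G adj? {U} U? two-U two-∁U
                 ((b₁ , b₂ , b₁∉U , b₂∉U , b₁↛b₂) , (a₁ , a₂ , a₁∈U , a₂∈U , a₁↛a₂)) =
  label , label-partition connected A.component-rest-apart B.component-rest-apart
  where
    module A = Side G (Reachability.reach? G adj? U?) two-U a₁∈U
    module B = Side G (Reachability.reach? G adj? (∁? U?)) two-∁U b₁∉U

    V : Fin 4 → Pred (Fin n) 0ℓ
    V zero                   = Reach G U a₁
    V (suc zero)             = Reach G (∁ U) b₁
    V (suc (suc zero))       = A.Rest
    V (suc (suc (suc zero))) = B.Rest

    classify : ∀ v → ∃[ i ] V i v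
    classify v with U? v | Reachability.reach? G adj? U? a₁ v | Reachability.reach? G adj? (∁? U?) b₁ v
    ... | yes v∈U | yes a₁⇝v | _        = zero , a₁⇝v
    ... | yes v∈U | no a₁↛v  | _        = suc (suc zero) , v∈U , a₁↛v
    ... | no v∉U  | _        | yes b₁⇝v = suc zero , b₁⇝v
    ... | no v∉U  | _        | no b₁↛v  = suc (suc (suc zero)) , v∉U , b₁↛v

    unique : ∀ {i j v} → V i v → V j v → i ≡ j
    unique {zero}                {zero}                 _          _          = refl
    unique {zero}                {suc zero}             a₁⇝v       b₁⇝v       = ⊥-elim (reach-end G b₁⇝v (reach-end G a₁⇝v))
    unique {zero}                {suc (suc zero)}       a₁⇝v       (_ , a₁↛v) = ⊥-elim (a₁↛v a₁⇝v)
    unique {zero}                {suc (suc (suc zero))} a₁⇝v       (v∉U , _)  = ⊥-elim (v∉U (reach-end G a₁⇝v))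
    unique {suc zero}            {zero}                 b₁⇝v       a₁⇝v       = ⊥-elim (reach-end G b₁⇝v (reach-end G a₁⇝v))
    unique {suc zero}            {suc zero}             _          _          = refl
    unique {suc zero}            {suc (suc zero)}       b₁⇝v       (v∈U , _)  = ⊥-elim (reach-end G b₁⇝v v∈U)
    unique {suc zero}            {suc (suc (suc zero))} b₁⇝v       (_ , b₁↛v) = ⊥-elim (b₁↛v b₁⇝v)
    unique {suc (suc zero)}      {zero}                 (_ , a₁↛v) a₁⇝v       = ⊥-elim (a₁↛v a₁⇝v)
    unique {suc (suc zero)}      {suc zero}             (v∈U , _)  b₁⇝v       = ⊥-elim (reach-end G b₁⇝v v∈U)
    unique {suc (suc zero)}      {suc (suc zero)}       _          _          = refl
    unique {suc (suc zero)}      {suc (suc (suc zero))} (v∈U , _)  (v∉U , _)  = ⊥-elim (v∉U v∈U)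
    unique {suc (suc (suc zero))} {zero}                (v∉U , _)  a₁⇝v       = ⊥-elim (v∉U (reach-end G a₁⇝v))
    unique {suc (suc (suc zero))} {suc zero}            (_ , b₁↛v) b₁⇝v       = ⊥-elim (b₁↛v b₁⇝v)
    unique {suc (suc (suc zero))} {suc (suc zero)}      (v∉U , _)  (v∈U , _)  = ⊥-elim (v∉U v∈U)
    unique {suc (suc (suc zero))} {suc (suc (suc zero))} _         _          = refl

    open Labelling G V classify unique

    connected : ∀ i → InducedConnected G (V i)
    connected zero                   = A.component-connected
    connected (suc zero)             = B.component-connected
    connected (suc (suc zero))       = A.rest-connected (a₂∈U , a₁↛a₂)
    connected (suc (suc (suc zero))) = B.rest-connected (b₂∉U , b₁↛b₂)

-- A decidable disconnected cut

¬¬-decidable : ∀ {n} (P : Pred (Fin n) 0ℓ) → ¬ ¬ Decidable P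
¬¬-decidable {zero}  P ¬dec = ¬dec λ ()
¬¬-decidable {suc n} P ¬dec = ¬¬-decidable (P ∘ suc) λ P? → ¬¬-excluded-middle λ P0? →
  ¬dec λ { zero → P0? ; (suc v) → P? v }

subset : ∀ {n} {P : Pred (Fin n) 0ℓ} → Decidable P → ∃[ S ] (P ≐ (_∈ₛ S))
subset {n} {P} P? = S , (λ {v} → to v) , (λ {v} → from v)
  where
    S : Subset n
    S = tabulate (does ∘ P?)
    to : ∀ v → P v → v ∈ₛ S
    to v p = lookup⇒[]= v S (≡.trans (lookup∘tabulate (does ∘ P?) v) (dec-true (P? v) p))
    from : ∀ v → v ∈ₛ S → P v
    from v v∈S with P? v | ≡.trans (≡.sym (lookup∘tabulate (does ∘ P?) v)) ([]=⇒lookup v∈S)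
    ... | yes p | _  = p
    ... | no _  | ()

decidable-cut : ∀ {n} (G : Graph n) → (∀ u v → Dec (Adj G u v)) →
                ∃ (DisconnectedCut G) → ∃[ U ] (Decidable U × DisconnectedCut G U)
decidable-cut G adj? (U , U-cut) =
  let S , S-cut = decidable-stable (anySubset? cut?) λ no-cut → ¬¬-decidable U λ U? →
                    let S , U≐S = subset U? in no-cut (S , disconnected-cut-resp U≐S U-cut)
  in (_∈ₛ S) , (_∈? S) , S-cut
  where
    disconnected? : ∀ {P} → Decidable P → Dec (InducedDisconnected G P)
    disconnected? P? = any? λ u → any? λ v → P? u ×-dec P? v ×-dec ¬? (Reachability.reach? G adj? P? u v)
    cut? : ∀ S → Dec (DisconnectedCut G (_∈ₛ S))
    cut? S = disconnected? (∁? (_∈? S)) ×-dec disconnected? (_∈? S)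

-- Arcs on the discretised circle

m≤n⊔o∧n<m⇒m≤o : ∀ {m n o} → m ≤ n ⊔ o → n < m → m ≤ o
m≤n⊔o∧n<m⇒m≤o {m} {n} {o} m≤n⊔o n<m with ≤-total n o
... | inj₁ n≤o = ≡.subst (m ≤_) (m≤n⇒m⊔n≡n n≤o) m≤n⊔o
... | inj₂ o≤n = contradiction (≡.subst (m ≤_) (m≥n⇒m⊔n≡m o≤n) m≤n⊔o) (<⇒≱ n<m)

[m%d+n]%d≡[m+n]%d : ∀ m n d .{{_ : NonZero d}} → (m % d + n) % d ≡ (m + n) % d
[m%d+n]%d≡[m+n]%d m n d = begin
  (m % d + n) % d          ≡⟨ %-distribˡ-+ (m % d) n d ⟩
  (m % d % d + n % d) % d  ≡⟨ ≡.cong (λ x → (x + n % d) % d) (m%n%n≡m%n m d) ⟩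
  (m % d + n % d) % d      ≡⟨ %-distribˡ-+ m n d ⟨
  (m + n) % d              ∎
  where open ≡.≡-Reasoning

[m+n%d]%d≡[m+n]%d : ∀ m n d .{{_ : NonZero d}} → (m + n % d) % d ≡ (m + n) % d
[m+n%d]%d≡[m+n]%d m n d = begin
  (m + n % d) % d  ≡⟨ ≡.cong (_% d) (+-comm m (n % d)) ⟩
  (n % d + m) % d  ≡⟨ [m%d+n]%d≡[m+n]%d n m d ⟩
  (n + m) % d      ≡⟨ ≡.cong (_% d) (+-comm n m) ⟩
  (m + n) % d      ∎
  where open ≡.≡-Reasoning

-- off s p is the forward distance from s to p, so that p ∈Arc arc s l _ unfolds to off s p ≤ l.
module Circle (k : ℕ) where

  M : ℕ
  M = suc k

  off : Fin M → Fin M → ℕ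
  off s p = (toℕ p + M ∸ toℕ s) % M

  off<M : ∀ s p → off s p < M
  off<M s p = m%n<n (toℕ p + M ∸ toℕ s) M

  off-sound : ∀ s p → (toℕ s + off s p) % M ≡ toℕ p
  off-sound s p = begin
    (toℕ s + (toℕ p + M ∸ toℕ s) % M) % M  ≡⟨ [m+n%d]%d≡[m+n]%d (toℕ s) (toℕ p + M ∸ toℕ s) M ⟩
    (toℕ s + (toℕ p + M ∸ toℕ s)) % M      ≡⟨ ≡.cong (_% M) (m+[n∸m]≡n (≤-trans (<⇒≤ (toℕ<n s)) (m≤n+m M (toℕ p)))) ⟩
    (toℕ p + M) % M                        ≡⟨ [m+n]%n≡m%n (toℕ p) M ⟩
    toℕ p % M                              ≡⟨ m<n⇒m%n≡m (toℕ<n p) ⟩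
    toℕ p                                  ∎
    where open ≡.≡-Reasoning

  off-unique : ∀ s p {d} → d < M → (toℕ s + d) % M ≡ toℕ p → off s p ≡ d
  off-unique s p {d} d<M s+d≡p = begin
    (toℕ p + M ∸ toℕ s) % M              ≡⟨ ≡.cong (_% M) (+-∸-assoc (toℕ p) (<⇒≤ (toℕ<n s))) ⟩
    (toℕ p + (M ∸ toℕ s)) % M            ≡⟨ ≡.cong (λ x → (x + (M ∸ toℕ s)) % M) s+d≡p ⟨
    ((toℕ s + d) % M + (M ∸ toℕ s)) % M  ≡⟨ [m%d+n]%d≡[m+n]%d (toℕ s + d) (M ∸ toℕ s) M ⟩
    (toℕ s + d + (M ∸ toℕ s)) % M        ≡⟨ ≡.cong (_% M) wrap ⟩
    (d + M) % M                          ≡⟨ [m+n]%n≡m%n d M ⟩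
    d % M                                ≡⟨ m<n⇒m%n≡m d<M ⟩
    d                                    ∎
    where
      open ≡.≡-Reasoning
      wrap : toℕ s + d + (M ∸ toℕ s) ≡ d + M
      wrap = begin
        toℕ s + d + (M ∸ toℕ s)    ≡⟨ ≡.cong (_+ (M ∸ toℕ s)) (+-comm (toℕ s) d) ⟩
        d + toℕ s + (M ∸ toℕ s)    ≡⟨ +-assoc d (toℕ s) (M ∸ toℕ s) ⟩
        d + (toℕ s + (M ∸ toℕ s))  ≡⟨ ≡.cong (d +_) (m+[n∸m]≡n (<⇒≤ (toℕ<n s))) ⟩
        d + M                      ∎

  off-self : ∀ s → off s s ≡ 0
  off-self s = off-unique s s (s≤s z≤n) (≡.trans (≡.cong (_% M) (+-identityʳ (toℕ s))) (m<n⇒m%n≡m (toℕ<n s)))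

  point-at : ∀ s {d} → d < M → ∃[ p ] off s p ≡ d
  point-at s {d} d<M = fromℕ< (m%n<n (toℕ s + d) M) , off-unique s _ d<M (≡.sym (toℕ-fromℕ< _))

  off-cases : ∀ s p {x} → x < M + M → (toℕ s + x) % M ≡ toℕ p → x ≡ off s p ⊎ x ≡ off s p + M
  off-cases s p {x} x<2M s+x≡p with x <? M
  ... | yes x<M = inj₁ (≡.sym (off-unique s p x<M s+x≡p))
  ... | no x≮M  = inj₂ (begin
    x          ≡⟨ m∸n+n≡m M≤x ⟨
    x ∸ M + M  ≡⟨ ≡.cong (_+ M) (off-unique s p (m<n+o⇒m∸n<o x M x<2M) s+[x∸M]≡p) ⟨
    off s p + M ∎)
    where
      open ≡.≡-Reasoning
      M≤x : M ≤ x
      M≤x = ≮⇒≥ x≮M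
      s+[x∸M]≡p : (toℕ s + (x ∸ M)) % M ≡ toℕ p
      s+[x∸M]≡p = begin
        (toℕ s + (x ∸ M)) % M      ≡⟨ [m+n]%n≡m%n (toℕ s + (x ∸ M)) M ⟨
        (toℕ s + (x ∸ M) + M) % M  ≡⟨ ≡.cong (_% M) (+-assoc (toℕ s) (x ∸ M) M) ⟩
        (toℕ s + (x ∸ M + M)) % M  ≡⟨ ≡.cong (λ y → (toℕ s + y) % M) (m∸n+n≡m M≤x) ⟩
        (toℕ s + x) % M            ≡⟨ s+x≡p ⟩
        toℕ p                      ∎

  off-cocycle : ∀ s t p → off s t + off t p ≡ off s p ⊎ off s t + off t p ≡ off s p + M
  off-cocycle s t p = off-cases s p (+-mono-< (off<M s t) (off<M t p)) (begin
    (toℕ s + (off s t + off t p)) % M    ≡⟨ ≡.cong (_% M) (+-assoc (toℕ s) (off s t) (off t p)) ⟨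
    (toℕ s + off s t + off t p) % M      ≡⟨ [m%d+n]%d≡[m+n]%d (toℕ s + off s t) (off t p) M ⟨
    ((toℕ s + off s t) % M + off t p) % M ≡⟨ ≡.cong (λ x → (x + off t p) % M) (off-sound s t) ⟩
    (toℕ t + off t p) % M                ≡⟨ off-sound t p ⟩
    toℕ p                                ∎)
    where open ≡.≡-Reasoning

  off-small : ∀ s t p → off s t + off t p < M → off s t + off t p ≡ off s p
  off-small s t p small with off-cocycle s t p
  ... | inj₁ eq = eq
  ... | inj₂ eq = contradiction (≡.subst (_< M) eq small) (m+n≮n (off s p) M)

  off-between : ∀ s t p → off s t ≤ off s p → off s t + off t p ≡ off s p
  off-between s t p t≤p with off-cocycle s t p
  ... | inj₁ eq = eq
  ... | inj₂ eq = contradiction M≤tp (<⇒≱ (off<M t p))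
    where
      open ≤-Reasoning
      M≤tp : M ≤ off t p
      M≤tp = +-cancelˡ-≤ (off s p) M (off t p) (begin
        off s p + M        ≡⟨ eq ⟨
        off s t + off t p  ≤⟨ +-monoˡ-≤ (off t p) t≤p ⟩
        off s p + off t p  ∎)

  off-rotate : ∀ s t c → off s c < off s t → off t s ≤ off t c
  off-rotate s t c c<t with off-cocycle t s c
  ... | inj₁ eq = ≡.subst (off t s ≤_) eq (m≤m+n (off t s) (off s c))
  ... | inj₂ eq = contradiction t≤c (<⇒≱ c<t)
    where
      open ≤-Reasoning
      round-trip : off s t + off t s ≡ M
      round-trip with off-cocycle s t s
      ... | inj₁ eq′ = contradiction (≡.subst (off s t ≤_) (≡.trans eq′ (off-self s)) (m≤m+n (off s t) (off t s)))
                                     (<⇒≱ (≤-<-trans z≤n c<t))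
      ... | inj₂ eq′ = ≡.trans eq′ (≡.cong (_+ M) (off-self s))
      t≤c : off s t ≤ off s c
      t≤c = +-cancelˡ-≤ (off t s) (off s t) (off s c) (begin
        off t s + off s t  ≡⟨ +-comm (off t s) (off s t) ⟩
        off s t + off t s  ≡⟨ round-trip ⟩
        M                  ≤⟨ m≤n+m M (off t c) ⟩
        off t c + M        ≡⟨ eq ⟨
        off t s + off s c  ∎)

  ⟦_⟧ : Arc M → Pred (Fin M) 0ℓ
  ⟦ α ⟧ p = p ∈Arc α

  _∈Arc?_ : ∀ p α → Dec (p ∈Arc α)
  p ∈Arc? arc s l _ = off s p ≤? l

  start∈Arc : ∀ α → Arc.start α ∈Arc α
  start∈Arc (arc s l _) = ≡.subst (_≤ l) (≡.sym (off-self s)) z≤n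

  IsUnion : Arc M → Arc M → Arc M → Set
  IsUnion α β γ = ⟦ γ ⟧ ⊆′ ⟦ α ⟧ ∪ ⟦ β ⟧ × ⟦ α ⟧ ⊆′ ⟦ γ ⟧ × ⟦ β ⟧ ⊆′ ⟦ γ ⟧

  within-or-past : ∀ s t {l} p → off s t ≤ l → off s p ≤ l ⊎ (l < off s p × off s t + off t p ≡ off s p)
  within-or-past s t {l} p t≤l with off s p ≤? l
  ... | yes p≤l = inj₁ p≤l
  ... | no p≰l  = inj₂ (≰⇒> p≰l , off-between s t p (≤-trans t≤l (<⇒≤ (≰⇒> p≰l))))

  -- γ starts with α and ends at the later of the two ends, or is the whole circle if β runs past
  -- the start of α.
  union-from-start : ∀ α β → Arc.start β ∈Arc α → ∃[ γ ] IsUnion α β γ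
  union-from-start (arc s l l<M) (arc t l′ _) t∈α with off s t + l′ <? M
  ... | yes fits = arc s (l ⊔ (off s t + l′)) (⊔-pres-<m l<M fits) , covered , (λ p → m≤n⇒m≤n⊔o _) , β⊆γ
    where
      open ≤-Reasoning
      β⊆γ : ∀ p → off t p ≤ l′ → off s p ≤ l ⊔ (off s t + l′)
      β⊆γ p p∈β = begin
        off s p             ≡⟨ off-small s t p (≤-<-trans (+-monoʳ-≤ (off s t) p∈β) fits) ⟨
        off s t + off t p   ≤⟨ +-monoʳ-≤ (off s t) p∈β ⟩
        off s t + l′        ≤⟨ m≤n⊔m l (off s t + l′) ⟩
        l ⊔ (off s t + l′)  ∎
      covered : ∀ p → off s p ≤ l ⊔ (off s t + l′) → off s p ≤ l ⊎ off t p ≤ l′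
      covered p p∈γ with within-or-past s t p t∈α
      ... | inj₁ p∈α        = inj₁ p∈α
      ... | inj₂ (l<p , eq) = inj₂ (+-cancelˡ-≤ (off s t) (off t p) l′
                                (≡.subst (_≤ off s t + l′) (≡.sym eq) (m≤n⊔o∧n<m⇒m≤o p∈γ l<p)))
  ... | no overflow = arc s k (n<1+n k) , covered , (λ p _ → <⇒≤pred (off<M s p)) , (λ p _ → <⇒≤pred (off<M s p))
    where
      open ≤-Reasoning
      covered : ∀ p → off s p ≤ k → off s p ≤ l ⊎ off t p ≤ l′
      covered p _ with within-or-past s t p t∈α
      ... | inj₁ p∈α      = inj₁ p∈α
      ... | inj₂ (_ , eq) = inj₂ (<⇒≤ (+-cancelˡ-< (off s t) (off t p) l′ (begin-strict
        off s t + off t p  ≡⟨ eq ⟩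
        off s p            <⟨ off<M s p ⟩
        M                  ≤⟨ ≮⇒≥ overflow ⟩
        off s t + l′       ∎)))

  start∈Arc-other : ∀ α β → ArcsIntersect α β → ¬ Arc.start β ∈Arc α → Arc.start α ∈Arc β
  start∈Arc-other (arc s l _) (arc t l′ _) (c , c∈α , c∈β) t∉α =
    ≤-trans (off-rotate s t c (≤-<-trans c∈α (≰⇒> t∉α))) c∈β

  union : ∀ α β → ArcsIntersect α β → ∃[ γ ] IsUnion α β γ
  union α β α∩β with Arc.start β ∈Arc? α
  ... | yes t∈α = union-from-start α β t∈α
  ... | no t∉α  = let γ , covered , β⊆γ , α⊆γ = union-from-start β α (start∈Arc-other α β α∩β t∉α)
                  in γ , (λ p → swap ∘ covered p) , α⊆γ , β⊆γ

  end : Arc M → Fin M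
  end (arc s l l<M) = proj₁ (point-at s l<M)

  off-end : ∀ α → off (Arc.start α) (end α) ≡ Arc.len α
  off-end (arc s l l<M) = proj₂ (point-at s l<M)

  -- γ runs from p ∈ α to a later point q ∉ α, so it leaves α through its end
  end∈Arc : ∀ α γ {p q} → p ∈Arc α → p ∈Arc γ → q ∈Arc γ → ¬ q ∈Arc α →
            off (Arc.start γ) p ≤ off (Arc.start γ) q → end α ∈Arc γ
  end∈Arc α@(arc s l l<M) (arc t L _) {p} {q} p∈α p∈γ q∈γ q∉α p≤q with off t p + off p (end α) <? off t q
  ... | yes e<q = begin
    off t (end α)            ≡⟨ off-small t p (end α) (<-trans e<q (off<M t q)) ⟨
    off t p + off p (end α)  ≤⟨ <⇒≤ e<q ⟩
    off t q                  ≤⟨ q∈γ ⟩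
    L                        ∎
    where open ≤-Reasoning
  ... | no e≮q = contradiction q∈α q∉α
    where
      open ≤-Reasoning
      p-to-end : off s p + off p (end α) ≡ l
      p-to-end = ≡.trans (off-between s p (end α) (≡.subst (off s p ≤_) (≡.sym (off-end α)) p∈α)) (off-end α)
      q≤end : off p q ≤ off p (end α)
      q≤end = +-cancelˡ-≤ (off t p) (off p q) (off p (end α)) (begin
        off t p + off p q        ≡⟨ off-between t p q p≤q ⟩
        off t q                  ≤⟨ ≮⇒≥ e≮q ⟩
        off t p + off p (end α)  ∎)
      p-to-q≤l : off s p + off p q ≤ l
      p-to-q≤l = ≤-trans (+-monoʳ-≤ (off s p) q≤end) (≤-reflexive p-to-end)
      q∈α : off s q ≤ l
      q∈α = ≡.subst (_≤ l) (off-small s p q (≤-<-trans p-to-q≤l l<M)) p-to-q≤l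

  meets-end : ∀ α β γ → ¬ ArcsIntersect α β → ArcsIntersect α γ → ArcsIntersect β γ →
              end α ∈Arc γ ⊎ end β ∈Arc γ
  meets-end α β γ α∩β=∅ (p , p∈α , p∈γ) (q , q∈β , q∈γ)
    with off (Arc.start γ) p ≤? off (Arc.start γ) q
  ... | yes p≤q = inj₁ (end∈Arc α γ p∈α p∈γ q∈γ (λ q∈α → α∩β=∅ (q , q∈α , q∈β)) p≤q)
  ... | no p≰q  = inj₂ (end∈Arc β γ q∈β q∈γ p∈γ (λ p∈β → α∩β=∅ (p , p∈α , p∈β)) (<⇒≤ (≰⇒> p≰q)))

  -- each γᵢ contains the end of α₁ or of α₂, so two of the three share an end
  arcs-K₂₃-free : ∀ α₁ α₂ γ₁ γ₂ γ₃ →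
    ¬ ArcsIntersect α₁ α₂ → ¬ ArcsIntersect γ₁ γ₂ → ¬ ArcsIntersect γ₁ γ₃ → ¬ ArcsIntersect γ₂ γ₃ →
    ArcsIntersect α₁ γ₁ → ArcsIntersect α₂ γ₁ → ArcsIntersect α₁ γ₂ → ArcsIntersect α₂ γ₂ →
    ArcsIntersect α₁ γ₃ → ArcsIntersect α₂ γ₃ → ⊥
  arcs-K₂₃-free α₁ α₂ γ₁ γ₂ γ₃ α₁₂ γ₁₂ γ₁₃ γ₂₃ a₁₁ a₂₁ a₁₂ a₂₂ a₁₃ a₂₃
    with meets-end α₁ α₂ γ₁ α₁₂ a₁₁ a₂₁ | meets-end α₁ α₂ γ₂ α₁₂ a₁₂ a₂₂ | meets-end α₁ α₂ γ₃ α₁₂ a₁₃ a₂₃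
  ... | inj₁ e₁ | inj₁ e₂ | _       = γ₁₂ (_ , e₁ , e₂)
  ... | inj₂ e₁ | inj₂ e₂ | _       = γ₁₂ (_ , e₁ , e₂)
  ... | inj₁ e₁ | inj₂ _  | inj₁ e₃ = γ₁₃ (_ , e₁ , e₃)
  ... | inj₁ _  | inj₂ e₂ | inj₂ e₃ = γ₂₃ (_ , e₂ , e₃)
  ... | inj₂ _  | inj₁ e₂ | inj₁ e₃ = γ₂₃ (_ , e₂ , e₃)
  ... | inj₂ e₁ | inj₁ _  | inj₂ e₃ = γ₁₃ (_ , e₁ , e₃)

-- Components of a circular-arc graph

module CircularArcModel {n} (G : Graph n) {k} (arcs : Fin n → Arc (suc k))
       (model : ∀ u v → u ≢ v → (Adj G u v ⇔ ArcsIntersect (arcs u) (arcs v))) where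
  open Circle k
  open Joined

  adj⇒meet : ∀ {u v} → Adj G u v → ArcsIntersect (arcs u) (arcs v)
  adj⇒meet {u} {v} u~v = Equivalence.to (model u v λ { refl → irrefl G u~v }) u~v

  meet⇒adj : ∀ {u v} → u ≢ v → ArcsIntersect (arcs u) (arcs v) → Adj G u v
  meet⇒adj {u} {v} u≢v = Equivalence.from (model u v u≢v)

  adj? : ∀ u v → Dec (Adj G u v)
  adj? u v with u ≟ v
  ... | yes refl = no (irrefl G)
  ... | no u≢v   = map′ (meet⇒adj u≢v) adj⇒meet (any? λ p → (p ∈Arc? arcs u) ×-dec (p ∈Arc? arcs v))

  Covered : Pred (Fin n) 0ℓ → Fin n → Arc M → Set
  Covered S r γ = ∀ p → p ∈Arc γ → ∃[ w ] (Reach G S r w × p ∈Arc arcs w)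

  covered-self : ∀ {S r} → S r → Covered S r (arcs r)
  covered-self r∈S p p∈r = _ , here r∈S , p∈r

  covered-step : ∀ {S r w γ} → S r → Adj G r w → Covered S w γ → Covered S r γ
  covered-step r∈S r~w cov p p∈γ = let x , w⇝x , p∈x = cov p p∈γ in x , step r∈S r~w w⇝x , p∈x

  covered-union : ∀ {S r} α β γ → ⟦ γ ⟧ ⊆′ ⟦ α ⟧ ∪ ⟦ β ⟧ → Covered S r α → Covered S r β → Covered S r γ
  covered-union _ _ _ γ⊆α∪β cov-α cov-β p p∈γ = [ cov-α p , cov-β p ]′ (γ⊆α∪β p p∈γ)

  covered-apart : ∀ {S r r′} γ γ′ → Covered S r γ → Covered S r′ γ′ → ¬ Reach G S r r′ → ¬ ArcsIntersect γ γ′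
  covered-apart _ _ cov cov′ r↛r′ (p , p∈γ , p∈γ′) with cov p p∈γ | cov′ p p∈γ′
  ... | w , r⇝w , p∈w | w′ , r′⇝w′ , p∈w′ with w ≟ w′
  ... | yes refl = r↛r′ (reach-trans G r⇝w (reach-sym G r′⇝w′))
  ... | no w≢w′  = r↛r′ (reach-trans G (reach-snoc G r⇝w (meet⇒adj w≢w′ (p , p∈w , p∈w′)) (reach-end G r′⇝w′))
                                        (reach-sym G r′⇝w′))

  path-region : ∀ {S r v} → Reach G S r v →
                ∃[ γ ] (Covered S r γ × ⟦ arcs r ⟧ ⊆′ ⟦ γ ⟧ × ⟦ arcs v ⟧ ⊆′ ⟦ γ ⟧)
  path-region {r = r} (here r∈S) = arcs r , covered-self r∈S , (λ _ p∈r → p∈r) , (λ _ p∈r → p∈r)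
  path-region {r = r} (step r∈S r~w w⇝v) with path-region w⇝v
  ... | γ , cov , w⊆γ , v⊆γ with union (arcs r) γ (let p , p∈r , p∈w = adj⇒meet r~w in p , p∈r , w⊆γ p p∈w)
  ... | δ , δ⊆r∪γ , r⊆δ , γ⊆δ =
    δ , covered-union (arcs r) γ δ δ⊆r∪γ (covered-self r∈S) (covered-step {γ = γ} r∈S r~w cov) ,
    r⊆δ , (λ p → γ⊆δ p ∘ v⊆γ p)

  region : ∀ {S r v vs} → Reach G S r v → List.All (Reach G S r) vs →
           ∃[ γ ] (Covered S r γ × ⟦ arcs r ⟧ ⊆′ ⟦ γ ⟧ × List.All (λ w → ⟦ arcs w ⟧ ⊆′ ⟦ γ ⟧) (v ∷ vs))
  region r⇝v [] = let γ , cov , r⊆γ , v⊆γ = path-region r⇝v in γ , cov , r⊆γ , v⊆γ ∷ []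
  region {r = r} r⇝v (r⇝w ∷ r⇝ws) with path-region r⇝v | region r⇝w r⇝ws
  ... | γ , cov-γ , r⊆γ , v⊆γ | δ , cov-δ , r⊆δ , ws⊆δ
    with union γ δ (Arc.start (arcs r) , r⊆γ _ (start∈Arc (arcs r)) , r⊆δ _ (start∈Arc (arcs r)))
  ... | ε , ε⊆γ∪δ , γ⊆ε , δ⊆ε =
    ε , covered-union γ δ ε ε⊆γ∪δ cov-γ cov-δ , (λ p → γ⊆ε p ∘ r⊆γ p) ,
    (λ p → γ⊆ε p ∘ v⊆γ p) ∷ List.map (λ w⊆δ p → δ⊆ε p ∘ w⊆δ p) ws⊆δ

  components-K₂₃-free : ∀ {S S′ r₁ r₂ r₃ s₁ s₂} →
    ¬ Reach G S r₁ r₂ → ¬ Reach G S r₁ r₃ → ¬ Reach G S r₂ r₃ → ¬ Reach G S′ s₁ s₂ →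
    Joined G S S′ r₁ s₁ → Joined G S S′ r₁ s₂ → Joined G S S′ r₂ s₁ → Joined G S S′ r₂ s₂ →
    Joined G S S′ r₃ s₁ → Joined G S S′ r₃ s₂ → ⊥
  components-K₂₃-free r₁↛r₂ r₁↛r₃ r₂↛r₃ s₁↛s₂ j₁₁ j₁₂ j₂₁ j₂₂ j₃₁ j₃₂
    with region (reach-near j₁₁) (reach-near j₁₂ ∷ []) | region (reach-near j₂₁) (reach-near j₂₂ ∷ [])
       | region (reach-near j₃₁) (reach-near j₃₂ ∷ [])
       | region (reach-far j₁₁) (reach-far j₂₁ ∷ reach-far j₃₁ ∷ [])
       | region (reach-far j₁₂) (reach-far j₂₂ ∷ reach-far j₃₂ ∷ [])
  ... | Γ₁ , c₁ , _ , z₁₁ ∷ z₁₂ ∷ [] | Γ₂ , c₂ , _ , z₂₁ ∷ z₂₂ ∷ [] | Γ₃ , c₃ , _ , z₃₁ ∷ z₃₂ ∷ []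
      | A₁ , d₁ , _ , x₁₁ ∷ x₂₁ ∷ x₃₁ ∷ [] | A₂ , d₂ , _ , x₁₂ ∷ x₂₂ ∷ x₃₂ ∷ [] =
    arcs-K₂₃-free A₁ A₂ Γ₁ Γ₂ Γ₃ (covered-apart A₁ A₂ d₁ d₂ s₁↛s₂)
      (covered-apart Γ₁ Γ₂ c₁ c₂ r₁↛r₂) (covered-apart Γ₁ Γ₃ c₁ c₃ r₁↛r₃) (covered-apart Γ₂ Γ₃ c₂ c₃ r₂↛r₃)
      (meet j₁₁ A₁ Γ₁ x₁₁ z₁₁) (meet j₁₂ A₂ Γ₁ x₁₂ z₁₂) (meet j₂₁ A₁ Γ₂ x₂₁ z₂₁)
      (meet j₂₂ A₂ Γ₂ x₂₂ z₂₂) (meet j₃₁ A₁ Γ₃ x₃₁ z₃₁) (meet j₃₂ A₂ Γ₃ x₃₂ z₃₂)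
    where
      meet : ∀ {S S′ r s} (j : Joined G S S′ r s) A Γ →
             ⟦ arcs (far j) ⟧ ⊆′ ⟦ A ⟧ → ⟦ arcs (near j) ⟧ ⊆′ ⟦ Γ ⟧ → ArcsIntersect A Γ
      meet j _ _ far⊆A near⊆Γ = let p , p∈near , p∈far = adj⇒meet (edge j)
                                in p , far⊆A p p∈far , near⊆Γ p p∈near

  at-most-two-components : WithinDistanceTwo G → ∀ {S S′} → (∀ w → S w ⊎ S′ w) → (∀ {w} → S w → ¬ S′ w) →
                           InducedDisconnected G S′ → AtMostTwoComponents G S
  at-most-two-components dist {S} {S′} cover disjoint (s₁ , s₂ , s₁∈S′ , s₂∈S′ , s₁↛s₂)
                         r₁∈S r₂∈S r₃∈S r₁↛r₂ r₁↛r₃ r₂↛r₃ =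
    components-K₂₃-free r₁↛r₂ r₁↛r₃ r₂↛r₃ s₁↛s₂
      (link r₁∈S s₁∈S′) (link r₁∈S s₂∈S′) (link r₂∈S s₁∈S′) (link r₂∈S s₂∈S′) (link r₃∈S s₁∈S′) (link r₃∈S s₂∈S′)
    where
      link : ∀ {r s} → S r → S′ s → Joined G S S′ r s
      link = joined-at-distance-two dist cover disjoint

lemma9 : ∀ {n} (G : Graph n) → IsCircularArcGraph G → Diameter2 G →
    (∃[ U ] DisconnectedCut G U) →
    ∃[ part ] (IsDisconnectedPartition G part × (∀ i → InducedConnected G (Part part i)))
lemma9 G (zero , arcs , _) (_ , _ , u , _) _ with Arc.len<m (arcs u)
... | ()
lemma9 G (suc k , arcs , model) (_ , dist , _) cut =
  let open CircularArcModel G arcs model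
      U , U? , U-cut = decidable-cut G adj? cut
      ∁U-disconnected , U-disconnected = U-cut
  in partition-of-cut G adj? U?
       (at-most-two-components dist (toSum ∘ U?) (λ u∈U u∉U → u∉U u∈U) ∁U-disconnected)
       (at-most-two-components dist (swap ∘ toSum ∘ U?) (λ u∉U u∈U → u∉U u∈U) U-disconnected)
       U-cut
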